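{- Let $\mathcal{I}$ be an interpreted system consistent with simple robot exploration, with a compact exploration space $X$. If $\mathcal{I}$ satisfies exploration liveness, then $\mathcal{I}\models\Diamond\,\mathrm{sp}(X)$.
   Context: $\Pi$ is a finite set of robots. An interpreted system $\mathcal{I}$ is a set of runs; each run $\rho$ is a sequence of global configurations indexed by discrete global time $[t]\in\mathbb{N}$; a point is a pair $(\rho,[t])$. Each configuration assigns each robot $r$ an epistemic (memory) state; $(\rho,[t])\sim_r(\rho',[t'])$ iff $r$ has the same epistemic state at both points, and for $A\subseteq\Pi$, $\sim_{D_A}=\bigcap_{r\in A}\sim_r$. The exploration space is $X\subseteq[0,1]^k$ with the Euclidean topology; to each open set $U$ corresponds an atom $\mathrm{sp}(U)$ ("$U$ has been explored"), evaluated by a valuation, with $\mathrm{sp}(V)\to\mathrm{sp}(U)$ whenever $U\subseteq V$, and the truth of finitely many $\mathrm{sp}(V_1),\dots,\mathrm{sp}(V_n)$ at a point entailing $\mathrm{sp}(V_1\cup\dots\cup V_n)$ there (space statements form a join-lattice under containment). Semantics: $K_r\varphi$ holds at a point iff $\varphi$ holds at all $\sim_r$-related points; $D_A\varphi$ likewise with $\sim_{D_A}$; $\Diamond\varphi$ holds at $(\rho,[t])$ iff $\varphi$ holds at $(\rho,[t'])$ for some $[t']\ge[t]$; $\Box\varphi:=\neg\Diamond\neg\varphi$. $\mathcal{I}\models\varphi$ means $\varphi$ holds at all points; $\mathcal{I},\rho\models\Diamond\varphi$ means $\varphi$ holds at some point of $\rho$. $\mathcal{I}$ is consistent with simple robot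 exploration if for all robots $r$ and open $U$: (agency) $\mathcal{I}\models\mathrm{sp}(U)\to D_\Pi\mathrm{sp}(U)$; (independence) whenever $D_A\mathrm{sp}(U)$ holds at a point, there are open $V_r$ ($r\in A$) with $\bigcup_{r\in A}V_r=U$ and $K_r\mathrm{sp}(V_r)$ holding there for each $r\in A$; (stability) $\mathcal{I}\models\mathrm{sp}(U)\to\Box\mathrm{sp}(U)$; (perfect recall) $\mathcal{I}\models K_r\mathrm{sp}(U)\to\Box K_r\mathrm{sp}(U)$. A run $\rho$ satisfies exploration liveness iff there is a collection $\mathcal{U}$ of open sets with $\bigcup\mathcal{U}=X$ and $\mathcal{I},\rho\models\Diamond\mathrm{sp}(U)$ for all $U\in\mathcal{U}$; $\mathcal{I}$ satisfies it iff all runs do. -}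

module Defs where

open import Data.Nat using (ℕ; _≤_)
open import Data.Fin using (Fin)
open import Data.Fin.Subset using (Subset; _∈_)
open import Data.Product using (Σ; _×_; _,_; proj₁)
open import Data.Unit using (⊤)
open import Data.Empty using (⊥)
open import Relation.Binary.PropositionalEquality using (_≡_)

-- Topological spaces (opens as predicates on the carrier).
-- The exploration space X is the carrier of the space.

record Topology : Set₁ where
  field
    Carrier  : Set
    IsOpen   : (Carrier → Set) → Set
    open-all : IsOpen (λ _ → ⊤)
    open-∅   : IsOpen (λ _ → ⊥)
    open-∩   : ∀ {P Q} → IsOpen P → IsOpen Q → IsOpen (λ x → P x × Q x)
    open-⋃   : {I : Set} (F : I → Carrier → Set) → (∀ i → IsOpen (F i)) →
               IsOpen (λ x → Σ I (λ i → F i x))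

module _ (T : Topology) where
  open Topology T

  OpenSet : Set₁
  OpenSet = Σ (Carrier → Set) IsOpen

  _∈ₒ_ : Carrier → OpenSet → Set
  x ∈ₒ U = proj₁ U x

  _⊆ₒ_ : OpenSet → OpenSet → Set
  U ⊆ₒ V = ∀ x → x ∈ₒ U → x ∈ₒ V

  wholeₒ : OpenSet
  wholeₒ = (λ _ → ⊤) , open-all

  finUnion : (n : ℕ) → (Fin n → OpenSet) → OpenSet
  finUnion n V = (λ x → Σ (Fin n) (λ i → x ∈ₒ V i)) , open-⋃ (λ i → proj₁ (V i)) (λ i → Data.Product.proj₂ (V i))

  Compact : Set₁
  Compact = (I : Set) (U : I → OpenSet) → (∀ x → Σ I (λ i → x ∈ₒ U i)) →
            Σ ℕ (λ n → Σ (Fin n → I) (λ f → ∀ x → Σ (Fin n) (λ j → x ∈ₒ U (f j))))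

-- Interpreted systems over robots Π = Fin m and exploration space T.

record InterpretedSystem (m : ℕ) (T : Topology) : Set₁ where
  field
    Run   : Set
    State : Set
    local : Fin m → Run → ℕ → State
    sp    : OpenSet T → Run → ℕ → Set
    sp-mono : ∀ U V → _⊆ₒ_ T U V → ∀ ρ t → sp V ρ t → sp U ρ t
    sp-join : ∀ n (V : Fin n → OpenSet T) ρ t →
              (∀ i → sp (V i) ρ t) → sp (finUnion T n V) ρ t

module _ {m : ℕ} {T : Topology} (𝓘 : InterpretedSystem m T) where
  open InterpretedSystem 𝓘

  -- formulas are interpreted semantically as predicates on points
  Form : Set₁
  Form = Run → ℕ → Set

  _⊢_∼_ : Fin m → (Run × ℕ) → (Run × ℕ) → Set
  r ⊢ (ρ , t) ∼ (ρ' , t') = local r ρ t ≡ local r ρ' t'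

  K : Fin m → Form → Form
  K r φ ρ t = ∀ ρ' t' → r ⊢ (ρ , t) ∼ (ρ' , t') → φ ρ' t'

  D : Subset m → Form → Form
  D A φ ρ t = ∀ ρ' t' → (∀ r → r ∈ A → r ⊢ (ρ , t) ∼ (ρ' , t')) → φ ρ' t'

  ◇ : Form → Form
  ◇ φ ρ t = Σ ℕ (λ t' → t ≤ t' × φ ρ t')

  -- □φ := ¬◇¬φ, written out (classically equivalently) as "φ at all later times"
  □ : Form → Form
  □ φ ρ t = ∀ t' → t ≤ t' → φ ρ t'

  _⇒_ : Form → Form → Form
  (φ ⇒ ψ) ρ t = φ ρ t → ψ ρ t

  ⊨ : Form → Set
  ⊨ φ = ∀ ρ t → φ ρ t

  full : Subset m
  full = Data.Fin.Subset.⊤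

  record SimpleRobotExploration : Set₁ where
    field
      agency       : ∀ U → ⊨ (sp U ⇒ D full (sp U))
      independence : ∀ (A : Subset m) U ρ t → D A (sp U) ρ t →
                     Σ ((r : Fin m) → r ∈ A → OpenSet T) (λ V →
                       (∀ x → (_∈ₒ_ T x U →
                                 Σ (Fin m) (λ r → Σ (r ∈ A) (λ r∈A → _∈ₒ_ T x (V r r∈A))))
                            × (Σ (Fin m) (λ r → Σ (r ∈ A) (λ r∈A → _∈ₒ_ T x (V r r∈A))) →
                                 _∈ₒ_ T x U))
                       × (∀ r (r∈A : r ∈ A) → K r (sp (V r r∈A)) ρ t))
      stability    : ∀ U → ⊨ (sp U ⇒ □ (sp U))
      perfectRecall : ∀ r U → ⊨ (K r (sp U) ⇒ □ (K r (sp U)))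

  RunLiveness : Run → Set₁
  RunLiveness ρ = Σ Set (λ I → Σ (I → OpenSet T) (λ 𝓤 →
                    (∀ x → Σ I (λ i → _∈ₒ_ T x (𝓤 i))) ×
                    (∀ i → Σ ℕ (λ t → sp (𝓤 i) ρ t))))

  ExplorationLiveness : Set₁
  ExplorationLiveness = ∀ ρ → RunLiveness ρ

{-# OPTIONS --safe #-}
-- By compactness the cover supplied by exploration liveness has a finite
-- subcover U₁, …, Uₙ. Each Uⱼ is explored at some time tⱼ and, by stability,
-- remains explored, so from max(t, t₁, …, tₙ) on all of them are explored at
-- once; the join law then yields sp(U₁ ∪ … ∪ Uₙ), which is sp(X) by
-- monotonicity.
module Submission where

open import Data.Nat using (ℕ; _≤_)
open import Data.Fin using (Fin)
open import Data.List using (tabulate)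
open import Data.List.Extrema.Nat using (max; ⊥≤max; xs≤max)
open import Data.List.Relation.Unary.All.Properties using (tabulate⁻)
open import Data.Product using (Σ; _×_; _,_; proj₁; proj₂)
open import Defs

commonLaterBound : ∀ {n} (t : ℕ) (g : Fin n → ℕ) → Σ ℕ (λ b → t ≤ b × (∀ j → g j ≤ b))
commonLaterBound t g =
  max t (tabulate g) , ⊥≤max t (tabulate g) , tabulate⁻ (xs≤max t (tabulate g))

module _ {m : ℕ} {T : Topology} (𝓘 : InterpretedSystem m T) where
  open InterpretedSystem 𝓘

  FiniteRunLiveness : Run → Set₁
  FiniteRunLiveness ρ =
    Σ ℕ (λ n → Σ (Fin n → OpenSet T) (λ V →
      _⊆ₒ_ T (wholeₒ T) (finUnion T n V) × (∀ j → Σ ℕ (sp (V j) ρ))))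

  compact⇒finiteRunLiveness : Compact T → ∀ ρ → RunLiveness 𝓘 ρ → FiniteRunLiveness ρ
  compact⇒finiteRunLiveness compact ρ (I , 𝓤 , covers , explored)
    with compact I 𝓤 covers
  ... | n , f , subcovers = n , (λ j → 𝓤 (f j)) , (λ x _ → subcovers x) , (λ j → explored (f j))

  ◇-sp-finUnion : (∀ U → ⊨ 𝓘 (_⇒_ 𝓘 (sp U) (□ 𝓘 (sp U)))) →
                  ∀ n (V : Fin n → OpenSet T) ρ → (∀ j → Σ ℕ (sp (V j) ρ)) →
                  ∀ t → ◇ 𝓘 (sp (finUnion T n V)) ρ t
  ◇-sp-finUnion stability n V ρ explored t =
    let (b , t≤b , tⱼ≤b) = commonLaterBound t tⱼ in
    b , t≤b , sp-join n V ρ b (λ j → stability (V j) ρ (tⱼ j) (proj₂ (explored j)) b (tⱼ≤b j))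
    where
    tⱼ : Fin n → ℕ
    tⱼ j = proj₁ (explored j)

  ◇-sp-mono : ∀ U V → _⊆ₒ_ T U V → ∀ ρ t → ◇ 𝓘 (sp V) ρ t → ◇ 𝓘 (sp U) ρ t
  ◇-sp-mono U V U⊆V ρ t (t' , t≤t' , spV) = t' , t≤t' , sp-mono U V U⊆V ρ t' spV

mainTheorem3 : (m : ℕ) (T : Topology) (𝓘 : InterpretedSystem m T) →
    SimpleRobotExploration 𝓘 → Compact T → ExplorationLiveness 𝓘 →
    ⊨ 𝓘 (◇ 𝓘 (InterpretedSystem.sp 𝓘 (wholeₒ T)))
mainTheorem3 m T 𝓘 robotExploration compact live ρ t
  with compact⇒finiteRunLiveness 𝓘 compact ρ (live ρ)
... | n , V , X⊆⋃V , explored =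
  ◇-sp-mono 𝓘 (wholeₒ T) (finUnion T n V) X⊆⋃V ρ t
    (◇-sp-finUnion 𝓘 (SimpleRobotExploration.stability robotExploration) n V ρ explored t)
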